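{- For $n\in\{1,2,3\}$, let $\mathbb B_n:=\mathbb Q(\cos(\pi/2^{n+1}))$, let $RE_n^+:=\{\epsilon\in\mathcal O_{\mathbb B_n}^\times\mid \mathrm{N}_{\mathbb B_n/\mathbb B_{n-1}}(\epsilon)=1\}$, and let $c_1:=2$, $c_n:=2\cdot\mathrm{round}(2^n/5)$ for $n\geq 2$ (so $c_2=2$, $c_3=4$). Then $$\min\{\mathrm{Tr}_{\mathbb B_n/\mathbb Q}(\epsilon^2)\mid \epsilon\in RE_n^+,\ \epsilon\neq\pm1\}=2^n(1+8c_n).$$
   Context: $\mathbb B_n$ is the $n$th layer of the cyclotomic $\mathbb Z_2$-extension of $\mathbb Q$ (with $\mathbb B_0=\mathbb Q$), of degree $2^n$; $\mathrm{N}_{\mathbb B_n/\mathbb B_{n-1}}$ is the relative norm to the index-$2$ subfield $\mathbb B_{n-1}$; $\mathrm{round}(x)$ is the nearest integer to $x$. -}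

module Defs where

open import Data.Nat as ℕ using (ℕ; zero; suc; _^_)
open import Data.Nat.DivMod using (_/_)
open import Data.Integer as ℤ using (ℤ; +_)
open import Data.Product using (_×_; _,_)
open import Relation.Binary.PropositionalEquality using (_≡_)

-- O n : the ring of integers of B_n = Q(cos(π/2^(n+1))), modelled concretely as
-- Z[β_n] with β_n = 2cos(π/2^(n+1)), built as a tower:
--   β_0 = 0,  β_(n+1)^2 = 2 + β_n,
-- so O (n+1) = O n [x]/(x^2 - (2 + β_n)); a pair (a , b) represents a + b·β_(n+1).
O : ℕ → Set
O zero    = ℤ
O (suc n) = O n × O n

ι : (n : ℕ) → ℤ → O n
ι zero    z = z
ι (suc n) z = ι n z , ι n (+ 0)

add : (n : ℕ) → O n → O n → O n
add zero    x y = x ℤ.+ y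
add (suc n) (a , b) (c , d) = add n a c , add n b d

neg : (n : ℕ) → O n → O n
neg zero    x = ℤ.- x
neg (suc n) (a , b) = neg n a , neg n b

sub : (n : ℕ) → O n → O n → O n
sub n x y = add n x (neg n y)

β : (n : ℕ) → O n
β zero    = + 0
β (suc n) = ι n (+ 0) , ι n (+ 1)

mutual
  mul : (n : ℕ) → O n → O n → O n
  mul zero    x y = x ℤ.* y
  mul (suc n) (a , b) (c , d) =
    add n (mul n a c) (mul n (mul n b d) (D n)) , add n (mul n a d) (mul n b c)

  D : (n : ℕ) → O n
  D n = add n (ι n (+ 2)) (β n)

relNorm : (n : ℕ) → O (suc n) → O n
relNorm n (a , b) = sub n (mul n a a) (mul n (mul n b b) (D n))

Tr : (n : ℕ) → O n → ℤ
Tr zero    x = x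
Tr (suc n) (a , b) = (+ 2) ℤ.* Tr n a

-- RE⁺_(n+1) = { ε ∈ O^× | N_{B_(n+1)/B_n}(ε) = 1 }
-- (norm 1 forces ε to be a unit: ε · σ(ε) = 1 with σ(ε) integral)
RE⁺ : (n : ℕ) → O (suc n) → Set
RE⁺ n ε = relNorm n ε ≡ ι n (+ 1)

-- round(2^n/5) = ⌊(2^n + 2)/5⌋ (no ties since 5 is odd)
c : ℕ → ℕ
c zero          = 2   -- unused
c (suc zero)    = 2
c (suc (suc k)) = 2 ℕ.* ((2 ^ suc (suc k) ℕ.+ 2) / 5)

{-# OPTIONS --safe #-}
module Submission where

-- Write ε ∈ O (n+1) as a + bβ with a, b ∈ O n, where β = β_(n+1) and β² = D = 2 + β_n.
-- Since ε² = (a² + b²D) + 2abβ and N(ε) = a² − b²D = 1, taking traces gives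
-- Tr(ε²) = 2^(n+1) + 4 Tr(b²D) and Tr(a²) = 2^n + Tr(b²D).  Both traces are positive definite
-- quadratic forms in the integer coordinates, and the claimed minimum is 2^(n+1) + 4B with
-- B = 8, 16, 64.  So it suffices that every ε ∈ RE⁺ with Tr(b²D) < B is ±1: this bounds the
-- coordinates of b, then of a, to explicit boxes that are searched exhaustively.  For n = 2 the
-- box for a is too large; instead, for each b ≠ 0 in its box, a² = 1 + b²D is refuted by
-- showing that 1 + b²D is not a square in O 2 modulo 4 or modulo 3.

open import Defs
open import Data.Nat as ℕ using (ℕ; zero; suc; _^_; _≤_; _<_; NonZero)
import Data.Nat.Properties as ℕP
open import Data.Integer as ℤ using (ℤ; +_; ∣_∣)
import Data.Integer.Properties as ℤP
open import Data.Integer.Divisibility.Signed using (_∣_; divides; _∣?_; ∣m∣n⇒∣m+n; ∣m⇒∣m*n; ∣n⇒∣m*n)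
open import Data.Integer.DivMod using (_%ℕ_; _/ℕ_; a≡a%ℕn+[a/ℕn]*n; n%ℕd<d)
open import Data.Integer.Tactic.RingSolver using (ring; solve-∀)
open import Data.Empty using (⊥-elim)
open import Data.List using (List; []; _∷_; map; upTo; cartesianProduct; deduplicate)
open import Data.List.Membership.Propositional using (_∈_)
open import Data.List.Membership.Propositional.Properties using (∈-map⁺; ∈-upTo⁺; ∈-cartesianProduct⁺)
open import Data.List.Relation.Unary.All as All using (All; all?)
open import Data.List.Relation.Unary.Any as Any using (Any; here; there)
import Data.List.Relation.Unary.Any.Properties as Anyₚ
open import Data.Product using (Σ; _×_; _,_; proj₁; proj₂)
open import Data.Product.Properties using (≡-dec)
open import Data.Sum using (_⊎_; inj₁; inj₂; [_,_]′)
open import Relation.Binary.PropositionalEquality using (_≡_; _≢_; refl; sym; trans; cong; cong₂; subst; module ≡-Reasoning)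
open import Relation.Nullary using (¬_; Dec; yes; no; ¬?)
open import Relation.Nullary.Decidable using (_×-dec_; _⊎-dec_; _→-dec_; from-yes)
open import Tactic.RingSolver.NonReflective ring using (solve; _⊜_; Expr; Κ; _⊕_; _⊗_)

_≟O_ : {n : ℕ} → (x y : O n) → Dec (x ≡ y)
_≟O_ {zero}  = ℤ._≟_
_≟O_ {suc n} = ≡-dec _≟O_ _≟O_

Tr-add : ∀ n x y → Tr n (add n x y) ≡ Tr n x ℤ.+ Tr n y
Tr-add zero    x       y       = refl
Tr-add (suc n) (a , _) (c , _) = trans (cong (+ 2 ℤ.*_) (Tr-add n a c)) (ℤP.*-distribˡ-+ (+ 2) (Tr n a) (Tr n c))

Tr-neg : ∀ n x → Tr n (neg n x) ≡ ℤ.- Tr n x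
Tr-neg zero    x       = refl
Tr-neg (suc n) (a , _) = trans (cong (+ 2 ℤ.*_) (Tr-neg n a)) (sym (ℤP.neg-distribʳ-* (+ 2) (Tr n a)))

Tr-one : ∀ n → Tr n (ι n (+ 1)) ≡ + (2 ^ n)
Tr-one zero    = refl
Tr-one (suc n) = trans (cong (+ 2 ℤ.*_) (Tr-one n)) (sym (ℤP.pos-* 2 (2 ^ n)))

Tr-sub : ∀ n x y → Tr n (sub n x y) ≡ Tr n x ℤ.- Tr n y
Tr-sub n x y = trans (Tr-add n x (neg n y)) (cong (ℤ._+_ (Tr n x)) (Tr-neg n y))

trSq trSqD : (n : ℕ) → O n → ℤ
trSq  n x = Tr n (mul n x x)
trSqD n x = Tr n (mul n (mul n x x) (D n))

Tr-square : ∀ n a b → trSq (suc n) (a , b) ≡ + 2 ℤ.* Tr n (relNorm n (a , b)) ℤ.+ + 4 ℤ.* trSqD n b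
Tr-square n a b = begin
  + 2 ℤ.* Tr n (add n (mul n a a) (mul n (mul n b b) (D n)))  ≡⟨ cong (+ 2 ℤ.*_) (Tr-add n _ _) ⟩
  + 2 ℤ.* (trSq n a ℤ.+ trSqD n b)                             ≡⟨ regroup (trSq n a) (trSqD n b) ⟩
  + 2 ℤ.* (trSq n a ℤ.- trSqD n b) ℤ.+ + 4 ℤ.* trSqD n b       ≡⟨ cong (λ t → + 2 ℤ.* t ℤ.+ + 4 ℤ.* trSqD n b) (Tr-sub n _ _) ⟨
  + 2 ℤ.* Tr n (relNorm n (a , b)) ℤ.+ + 4 ℤ.* trSqD n b       ∎
  where
  open ≡-Reasoning
  regroup : ∀ x y → + 2 ℤ.* (x ℤ.+ y) ≡ + 2 ℤ.* (x ℤ.- y) ℤ.+ + 4 ℤ.* y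
  regroup = solve-∀

sub≡⇒≡add : ∀ n {x y z} → sub n x y ≡ z → x ≡ add n z y
sub≡⇒≡add zero    {x} {y} refl = cancel x y
  where
  cancel : ∀ x y → x ≡ (x ℤ.- y) ℤ.+ y
  cancel = solve-∀
sub≡⇒≡add (suc n) {_ , _} {_ , _} {_ , _} eq =
  cong₂ _,_ (sub≡⇒≡add n (cong proj₁ eq)) (sub≡⇒≡add n (cong proj₂ eq))

forcedSquare : (n : ℕ) → O n → O n
forcedSquare n b = add n (ι n (+ 1)) (mul n (mul n b b) (D n))

RE⁺⇒square : ∀ n a b → RE⁺ n (a , b) → mul n a a ≡ forcedSquare n b
RE⁺⇒square n a b = sub≡⇒≡add n

Tr-relNorm-RE⁺ : ∀ n {ε} → RE⁺ n ε → Tr n (relNorm n ε) ≡ + (2 ^ n)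
Tr-relNorm-RE⁺ n norm = trans (cong (Tr n) norm) (Tr-one n)

trSq-RE⁺ : ∀ n a b → RE⁺ n (a , b) → trSq (suc n) (a , b) ≡ + (2 ^ suc n) ℤ.+ + 4 ℤ.* trSqD n b
trSq-RE⁺ n a b norm = begin
  trSq (suc n) (a , b)                                    ≡⟨ Tr-square n a b ⟩
  + 2 ℤ.* Tr n (relNorm n (a , b)) ℤ.+ + 4 ℤ.* trSqD n b   ≡⟨ cong (λ t → + 2 ℤ.* t ℤ.+ + 4 ℤ.* trSqD n b) (Tr-relNorm-RE⁺ n norm) ⟩
  + 2 ℤ.* + (2 ^ n) ℤ.+ + 4 ℤ.* trSqD n b                  ≡⟨ cong (ℤ._+ + 4 ℤ.* trSqD n b) (ℤP.pos-* 2 (2 ^ n)) ⟨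
  + (2 ^ suc n) ℤ.+ + 4 ℤ.* trSqD n b                      ∎
  where open ≡-Reasoning

trSq-proj₁-RE⁺ : ∀ n a b → RE⁺ n (a , b) → trSq n a ≡ + (2 ^ n) ℤ.+ trSqD n b
trSq-proj₁-RE⁺ n a b norm = begin
  trSq n a                                ≡⟨ sub≡⇒≡add 0 refl ⟩
  (trSq n a ℤ.- trSqD n b) ℤ.+ trSqD n b   ≡⟨ cong (ℤ._+ trSqD n b) (Tr-sub n _ _) ⟨
  Tr n (relNorm n (a , b)) ℤ.+ trSqD n b   ≡⟨ cong (ℤ._+ trSqD n b) (Tr-relNorm-RE⁺ n norm) ⟩
  + (2 ^ n) ℤ.+ trSqD n b                  ∎
  where open ≡-Reasoning

trSq-proj₁<-RE⁺ : ∀ n a b {B} → RE⁺ n (a , b) → trSqD n b ℤ.< + B → trSq n a ℤ.< + (2 ^ n ℕ.+ B)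
trSq-proj₁<-RE⁺ n a b norm small = subst (ℤ._< _) (sym (trSq-proj₁-RE⁺ n a b norm)) (ℤP.+-monoʳ-< (+ (2 ^ n)) small)

Is±1 : (n : ℕ) → O n → Set
Is±1 n ε = ε ≡ ι n (+ 1) ⊎ ε ≡ ι n (ℤ.- (+ 1))

SmallUnitTrivial : (n B : ℕ) → O (suc n) → Set
SmallUnitTrivial n B (a , b) = RE⁺ n (a , b) → trSqD n b ℤ.< + B → Is±1 (suc n) (a , b)

smallUnitTrivial? : ∀ n B ε → Dec (SmallUnitTrivial n B ε)
smallUnitTrivial? n B (a , b) =
  relNorm n (a , b) ≟O ι n (+ 1) →-dec trSqD n b ℤP.<? + B →-dec
    ((a , b) ≟O ι (suc n) (+ 1) ⊎-dec (a , b) ≟O ι (suc n) (ℤ.- (+ 1)))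

RE⁺-trace-lower-bound : ∀ n B → (∀ ε → SmallUnitTrivial n B ε) →
  ∀ ε → RE⁺ n ε → ε ≢ ι (suc n) (+ 1) → ε ≢ ι (suc n) (ℤ.- (+ 1)) →
  + (2 ^ suc n) ℤ.+ + 4 ℤ.* + B ℤ.≤ trSq (suc n) ε
RE⁺-trace-lower-bound n B trivial (a , b) norm ≢1 ≢-1 with trSqD n b ℤP.<? + B
... | yes small = ⊥-elim ([ ≢1 , ≢-1 ]′ (trivial (a , b) norm small))
... | no ¬small = subst (_ ℤ.≤_) (sym (trSq-RE⁺ n a b norm))
                    (ℤP.+-monoʳ-≤ (+ (2 ^ suc n)) (ℤP.*-monoˡ-≤-nonNeg (+ 4) (ℤP.≮⇒≥ ¬small)))

symRange : ℕ → List ℤ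
symRange zero    = + 0 ∷ []
symRange (suc K) = + suc K ∷ ℤ.-[1+ K ] ∷ symRange K

∈-symRange : ∀ {K} x → ∣ x ∣ ≤ K → x ∈ symRange K
∈-symRange {zero}  (+ zero) _ = here refl
∈-symRange {suc K} (+ n) ∣x∣≤ with ℕP.m≤n⇒m<n∨m≡n ∣x∣≤
... | inj₂ refl       = here refl
... | inj₁ (ℕ.s≤s n≤) = there (there (∈-symRange (+ n) n≤))
∈-symRange {suc K} ℤ.-[1+ n ] (ℕ.s≤s n≤) with ℕP.m≤n⇒m<n∨m≡n n≤
... | inj₂ refl = there (here refl)
... | inj₁ n<  = there (there (∈-symRange ℤ.-[1+ n ] n<))

Bound : ℕ → Set
Bound zero    = ℕ
Bound (suc n) = Bound n × Bound n

InBox : (n : ℕ) → Bound n → O n → Set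
InBox zero    K        x       = ∣ x ∣ ≤ K
InBox (suc n) (K , K′) (a , b) = InBox n K a × InBox n K′ b

box : (n : ℕ) → Bound n → List (O n)
box zero    K        = symRange K
box (suc n) (K , K′) = cartesianProduct (box n K) (box n K′)

∈-box : ∀ n {K} x → InBox n K x → x ∈ box n K
∈-box zero    x       inBox       = ∈-symRange x inBox
∈-box (suc n) (a , b) (inA , inB) = ∈-cartesianProduct⁺ (∈-box n a inA) (∈-box n b inB)

smallUnitTrivial-byBox : ∀ n B (K : Bound (suc n)) → All (SmallUnitTrivial n B) (box (suc n) K) →
  (∀ a b → RE⁺ n (a , b) → trSqD n b ℤ.< + B → InBox (suc n) K (a , b)) →
  ∀ ε → SmallUnitTrivial n B ε
smallUnitTrivial-byBox n B K checked inBox (a , b) norm small =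
  All.lookup checked (∈-box (suc n) (a , b) (inBox a b norm small)) norm small

sq : ℤ → ℕ
sq x = ∣ x ∣ ℕ.* ∣ x ∣

*-self≡sq : ∀ x → x ℤ.* x ≡ + sq x
*-self≡sq (+ n)      = ℤP.+◃n≡+n (n ℕ.* n)
*-self≡sq ℤ.-[1+ n ] = refl

*-pos : ∀ k {x n} → x ≡ + n → + k ℤ.* x ≡ + (k ℕ.* n)
*-pos k {n = n} refl = sym (ℤP.pos-* k n)

*-sq : ∀ k x → + k ℤ.* (x ℤ.* x) ≡ + (k ℕ.* sq x)
*-sq k x = *-pos k (*-self≡sq x)

<-of-≡+ : ∀ {x m n} → x ≡ + m → x ℤ.< + n → m < n
<-of-≡+ refl = ℤP.drop‿+<+

∣∣≤-of-sq< : ∀ x K → sq x < suc K ℕ.* suc K → ∣ x ∣ ≤ K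
∣∣≤-of-sq< x K sq< with ∣ x ∣ ℕ.≤? K
... | yes ∣x∣≤K = ∣x∣≤K
... | no  ∣x∣≰K = ⊥-elim (ℕP.<⇒≱ sq< (ℕP.*-mono-≤ K<∣x∣ K<∣x∣))
  where K<∣x∣ = ℕP.≰⇒> ∣x∣≰K

∣∣≤-sub : ∀ {x} y z {j k} → x ≡ y ℤ.- z → ∣ y ∣ ≤ j → ∣ z ∣ ≤ k → ∣ x ∣ ≤ j ℕ.+ k
∣∣≤-sub y z refl ∣y∣≤ ∣z∣≤ = ℕP.≤-trans (ℤP.∣i-j∣≤∣i∣+∣j∣ y z) (ℕP.+-mono-≤ ∣y∣≤ ∣z∣≤)

summands< : ∀ a b c d {n} → a ℕ.+ b ℕ.+ c ℕ.+ d < n → a < n × b < n × c < n × d < n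
summands< a b c d sum< =
  below (ℕP.≤-trans (ℕP.≤-trans (ℕP.m≤m+n a b) (ℕP.m≤m+n (a ℕ.+ b) c)) (ℕP.m≤m+n (a ℕ.+ b ℕ.+ c) d)) ,
  below (ℕP.≤-trans (ℕP.≤-trans (ℕP.m≤n+m b a) (ℕP.m≤m+n (a ℕ.+ b) c)) (ℕP.m≤m+n (a ℕ.+ b ℕ.+ c) d)) ,
  below (ℕP.≤-trans (ℕP.m≤n+m c (a ℕ.+ b)) (ℕP.m≤m+n (a ℕ.+ b ℕ.+ c) d)) ,
  below (ℕP.m≤n+m d (a ℕ.+ b ℕ.+ c))
  where
  below : ∀ {x} → x ≤ a ℕ.+ b ℕ.+ c ℕ.+ d → x < _
  below x≤ = ℕP.≤-<-trans x≤ sum<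

x≡[x+y]-y : ∀ x y → x ≡ (x ℤ.+ y) ℤ.- y
x≡[x+y]-y = solve-∀

-- The tower of Defs over the solver's expression syntax: the semantics of trSqₑ and trSqDₑ
-- unfold to trSq and trSqD, so that identities about them can be handed to solve.
Oₑ : ℕ → ℕ → Set
Oₑ k zero    = Expr ℤ k
Oₑ k (suc n) = Oₑ k n × Oₑ k n

module _ {k : ℕ} where

  ιₑ : (n : ℕ) → ℤ → Oₑ k n
  ιₑ zero    z = Κ z
  ιₑ (suc n) z = ιₑ n z , ιₑ n (+ 0)

  addₑ : (n : ℕ) → Oₑ k n → Oₑ k n → Oₑ k n
  addₑ zero    x       y       = x ⊕ y
  addₑ (suc n) (a , b) (c , d) = addₑ n a c , addₑ n b d

  βₑ : (n : ℕ) → Oₑ k n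
  βₑ zero    = Κ (+ 0)
  βₑ (suc n) = ιₑ n (+ 0) , ιₑ n (+ 1)

  mutual
    mulₑ : (n : ℕ) → Oₑ k n → Oₑ k n → Oₑ k n
    mulₑ zero    x       y       = x ⊗ y
    mulₑ (suc n) (a , b) (c , d) =
      addₑ n (mulₑ n a c) (mulₑ n (mulₑ n b d) (Dₑ n)) , addₑ n (mulₑ n a d) (mulₑ n b c)

    Dₑ : (n : ℕ) → Oₑ k n
    Dₑ n = addₑ n (ιₑ n (+ 2)) (βₑ n)

  Trₑ : (n : ℕ) → Oₑ k n → Expr ℤ k
  Trₑ zero    x       = x
  Trₑ (suc n) (a , _) = Κ (+ 2) ⊗ Trₑ n a

  trSqₑ trSqDₑ : (n : ℕ) → Oₑ k n → Expr ℤ k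
  trSqₑ  n x = Trₑ n (mulₑ n x x)
  trSqDₑ n x = Trₑ n (mulₑ n (mulₑ n x x) (Dₑ n))

trSqD₀ : ∀ y → trSqD 0 y ≡ + (2 ℕ.* sq y)
trSqD₀ y = trans (form y) (*-sq 2 y)
  where
  form : ∀ y → trSqD 0 y ≡ + 2 ℤ.* (y ℤ.* y)
  form = solve 1 (λ y → trSqDₑ 0 y ⊜ Κ (+ 2) ⊗ (y ⊗ y)) refl

trSq₁ : ∀ a₀ a₁ → trSq 1 (a₀ , a₁) ≡ + (2 ℕ.* (sq a₀ ℕ.+ 2 ℕ.* sq a₁))
trSq₁ a₀ a₁ = trans (form a₀ a₁) (*-pos 2 (cong₂ ℤ._+_ (*-self≡sq a₀) (*-sq 2 a₁)))
  where
  form : ∀ a₀ a₁ → trSq 1 (a₀ , a₁) ≡ + 2 ℤ.* (a₀ ℤ.* a₀ ℤ.+ + 2 ℤ.* (a₁ ℤ.* a₁))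
  form = solve 2 (λ a₀ a₁ → trSqₑ 1 (a₀ , a₁) ⊜ Κ (+ 2) ⊗ (a₀ ⊗ a₀ ⊕ Κ (+ 2) ⊗ (a₁ ⊗ a₁))) refl

trSqD₁ : ∀ b₀ b₁ → trSqD 1 (b₀ , b₁) ≡ + (4 ℕ.* (sq (b₀ ℤ.+ b₁) ℕ.+ sq b₁))
trSqD₁ b₀ b₁ = trans (form b₀ b₁) (*-pos 4 (cong₂ ℤ._+_ (*-self≡sq (b₀ ℤ.+ b₁)) (*-self≡sq b₁)))
  where
  form : ∀ b₀ b₁ → trSqD 1 (b₀ , b₁) ≡ + 4 ℤ.* ((b₀ ℤ.+ b₁) ℤ.* (b₀ ℤ.+ b₁) ℤ.+ b₁ ℤ.* b₁)
  form = solve 2 (λ b₀ b₁ → trSqDₑ 1 (b₀ , b₁) ⊜ Κ (+ 4) ⊗ ((b₀ ⊕ b₁) ⊗ (b₀ ⊕ b₁) ⊕ b₁ ⊗ b₁)) refl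

trSq₂ : ∀ p q r s → trSq 2 ((p , q) , (r , s)) ≡
  + (4 ℕ.* (sq p ℕ.+ 2 ℕ.* sq q ℕ.+ 2 ℕ.* sq (r ℤ.+ s) ℕ.+ 2 ℕ.* sq s))
trSq₂ p q r s = trans (form p q r s)
  (*-pos 4 (cong₂ ℤ._+_ (cong₂ ℤ._+_ (cong₂ ℤ._+_ (*-self≡sq p) (*-sq 2 q)) (*-sq 2 (r ℤ.+ s))) (*-sq 2 s)))
  where
  form : ∀ p q r s → trSq 2 ((p , q) , (r , s)) ≡
    + 4 ℤ.* (p ℤ.* p ℤ.+ + 2 ℤ.* (q ℤ.* q) ℤ.+ + 2 ℤ.* ((r ℤ.+ s) ℤ.* (r ℤ.+ s)) ℤ.+ + 2 ℤ.* (s ℤ.* s))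
  form = solve 4 (λ p q r s → trSqₑ 2 ((p , q) , (r , s)) ⊜
    Κ (+ 4) ⊗ (p ⊗ p ⊕ Κ (+ 2) ⊗ (q ⊗ q) ⊕ Κ (+ 2) ⊗ ((r ⊕ s) ⊗ (r ⊕ s)) ⊕ Κ (+ 2) ⊗ (s ⊗ s))) refl

trSqD₂ : ∀ u₁ u₂ v₁ v₂ → trSqD 2 ((u₁ , u₂) , (v₁ , v₂)) ≡
  + (4 ℕ.* (2 ℕ.* sq (u₁ ℤ.+ v₁ ℤ.+ v₂) ℕ.+ sq (+ 2 ℤ.* u₂ ℤ.+ v₁ ℤ.+ + 2 ℤ.* v₂) ℕ.+ sq v₁ ℕ.+ 2 ℕ.* sq v₂))
trSqD₂ u₁ u₂ v₁ v₂ = trans (form u₁ u₂ v₁ v₂)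
  (*-pos 4 (cong₂ ℤ._+_ (cong₂ ℤ._+_ (cong₂ ℤ._+_ (*-sq 2 L₁) (*-self≡sq L₂)) (*-self≡sq v₁)) (*-sq 2 v₂)))
  where
  L₁ L₂ : ℤ
  L₁ = u₁ ℤ.+ v₁ ℤ.+ v₂
  L₂ = + 2 ℤ.* u₂ ℤ.+ v₁ ℤ.+ + 2 ℤ.* v₂
  form : ∀ u₁ u₂ v₁ v₂ → trSqD 2 ((u₁ , u₂) , (v₁ , v₂)) ≡
    + 4 ℤ.* (+ 2 ℤ.* ((u₁ ℤ.+ v₁ ℤ.+ v₂) ℤ.* (u₁ ℤ.+ v₁ ℤ.+ v₂))
             ℤ.+ (+ 2 ℤ.* u₂ ℤ.+ v₁ ℤ.+ + 2 ℤ.* v₂) ℤ.* (+ 2 ℤ.* u₂ ℤ.+ v₁ ℤ.+ + 2 ℤ.* v₂)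
             ℤ.+ v₁ ℤ.* v₁ ℤ.+ + 2 ℤ.* (v₂ ℤ.* v₂))
  form = solve 4 (λ u₁ u₂ v₁ v₂ → trSqDₑ 2 ((u₁ , u₂) , (v₁ , v₂)) ⊜
    Κ (+ 4) ⊗ (Κ (+ 2) ⊗ ((u₁ ⊕ v₁ ⊕ v₂) ⊗ (u₁ ⊕ v₁ ⊕ v₂))
               ⊕ (Κ (+ 2) ⊗ u₂ ⊕ v₁ ⊕ Κ (+ 2) ⊗ v₂) ⊗ (Κ (+ 2) ⊗ u₂ ⊕ v₁ ⊕ Κ (+ 2) ⊗ v₂)
               ⊕ v₁ ⊗ v₁ ⊕ Κ (+ 2) ⊗ (v₂ ⊗ v₂))) refl

module Modulo (M : ℕ) .{{_ : NonZero M}} where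

  Congruent : (n : ℕ) → O n → O n → Set
  Congruent zero    x       y       = + M ∣ x ℤ.- y
  Congruent (suc n) (a , b) (c , d) = Congruent n a c × Congruent n b d

  congruent? : ∀ n x y → Dec (Congruent n x y)
  congruent? zero    x       y       = + M ∣? x ℤ.- y
  congruent? (suc n) (a , b) (c , d) = congruent? n a c ×-dec congruent? n b d

  congruent-refl : ∀ n x → Congruent n x x
  congruent-refl zero    x       = subst (+ M ∣_) (sym (ℤP.+-inverseʳ x)) (divides (+ 0) refl)
  congruent-refl (suc n) (a , b) = congruent-refl n a , congruent-refl n b

  congruent-trans : ∀ n {x y z} → Congruent n x y → Congruent n y z → Congruent n x z
  congruent-trans zero {x} {y} {z} x≈y y≈z = subst (+ M ∣_) (ℤP.+-minus-telescope x y z) (∣m∣n⇒∣m+n x≈y y≈z)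
  congruent-trans (suc n) {_ , _} {_ , _} {_ , _} (a≈ , b≈) (c≈ , d≈) =
    congruent-trans n a≈ c≈ , congruent-trans n b≈ d≈

  add-cong : ∀ n {x x′ y y′} → Congruent n x y → Congruent n x′ y′ → Congruent n (add n x x′) (add n y y′)
  add-cong zero {x} {x′} {y} {y′} x≈y x′≈y′ = subst (+ M ∣_) (regroup x x′ y y′) (∣m∣n⇒∣m+n x≈y x′≈y′)
    where
    regroup : ∀ x x′ y y′ → (x ℤ.- y) ℤ.+ (x′ ℤ.- y′) ≡ (x ℤ.+ x′) ℤ.- (y ℤ.+ y′)
    regroup = solve-∀
  add-cong (suc n) {_ , _} {_ , _} {_ , _} {_ , _} (a≈ , b≈) (c≈ , d≈) = add-cong n a≈ c≈ , add-cong n b≈ d≈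

  mul-cong : ∀ n {x x′ y y′} → Congruent n x y → Congruent n x′ y′ → Congruent n (mul n x x′) (mul n y y′)
  mul-cong zero {x} {x′} {y} {y′} x≈y x′≈y′ =
    subst (+ M ∣_) (regroup x x′ y y′) (∣m∣n⇒∣m+n (∣m⇒∣m*n x′ x≈y) (∣n⇒∣m*n y x′≈y′))
    where
    regroup : ∀ x x′ y y′ → (x ℤ.- y) ℤ.* x′ ℤ.+ y ℤ.* (x′ ℤ.- y′) ≡ x ℤ.* x′ ℤ.- y ℤ.* y′
    regroup = solve-∀
  mul-cong (suc n) {_ , _} {_ , _} {_ , _} {_ , _} (a≈ , b≈) (c≈ , d≈) =
    add-cong n (mul-cong n a≈ c≈) (mul-cong n (mul-cong n b≈ d≈) (congruent-refl n (D n))) ,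
    add-cong n (mul-cong n a≈ d≈) (mul-cong n b≈ c≈)

  reduce : (n : ℕ) → O n → O n
  reduce zero    x       = + (x %ℕ M)
  reduce (suc n) (a , b) = reduce n a , reduce n b

  congruent-reduce : ∀ n x → Congruent n x (reduce n x)
  congruent-reduce zero    x       = divides (x /ℕ M)
    (trans (cong (ℤ._- + (x %ℕ M)) (a≡a%ℕn+[a/ℕn]*n x M)) (cancel (+ (x %ℕ M)) (x /ℕ M) (+ M)))
    where
    cancel : ∀ r q m → (r ℤ.+ q ℤ.* m) ℤ.- r ≡ q ℤ.* m
    cancel = solve-∀
  congruent-reduce (suc n) (a , b) = congruent-reduce n a , congruent-reduce n b

  residues : (n : ℕ) → List (O n)
  residues zero    = map +_ (upTo M)
  residues (suc n) = cartesianProduct (residues n) (residues n)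

  reduce∈residues : ∀ n x → reduce n x ∈ residues n
  reduce∈residues zero    x       = ∈-map⁺ +_ (∈-upTo⁺ (n%ℕd<d x M))
  reduce∈residues (suc n) (a , b) = ∈-cartesianProduct⁺ (reduce∈residues n a) (reduce∈residues n b)

  squares : (n : ℕ) → List (O n)
  squares n = deduplicate _≟O_ (map (λ r → reduce n (mul n r r)) (residues n))

  square-congruent-to-squares : ∀ n a → Any (Congruent n (mul n a a)) (squares n)
  square-congruent-to-squares n a =
    Anyₚ.deduplicate⁺ _≟O_ (λ { refl c → c })
      (Any.map (λ { refl → a²≈r² }) (∈-map⁺ (λ r → reduce n (mul n r r)) (reduce∈residues n a)))
    where
    r : O n
    r = reduce n a
    a²≈r² : Congruent n (mul n a a) (reduce n (mul n r r))
    a²≈r² = congruent-trans n (mul-cong n (congruent-reduce n a) (congruent-reduce n a)) (congruent-reduce n (mul n r r))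

  Avoids : (n : ℕ) → List (O n) → O n → Set
  Avoids n S X = All (λ s → ¬ Congruent n X s) S

  avoids? : ∀ n S X → Dec (Avoids n S X)
  avoids? n S X = all? (λ s → ¬? (congruent? n X s)) S

  avoids-squares⇒≢square : ∀ n {X} a → Avoids n (squares n) X → X ≢ mul n a a
  avoids-squares⇒≢square n a avoids refl with All.lookupAny avoids (square-congruent-to-squares n a)
  ... | X≉s , X≈s = X≉s X≈s

smallUnitTrivial₀ : ∀ ε → SmallUnitTrivial 0 8 ε
smallUnitTrivial₀ = smallUnitTrivial-byBox 0 8 (2 , 1) (from-yes (all? (smallUnitTrivial? 0 8) (box 1 (2 , 1)))) inBox
  where
  inBox : ∀ x y → RE⁺ 0 (x , y) → trSqD 0 y ℤ.< + 8 → InBox 1 (2 , 1) (x , y)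
  inBox x y norm small =
    ∣∣≤-of-sq< x 2 (<-of-≡+ (*-self≡sq x) (trSq-proj₁<-RE⁺ 0 x y norm small)) ,
    ∣∣≤-of-sq< y 1 (ℕP.*-cancelˡ-< 2 _ _ (<-of-≡+ (trSqD₀ y) small))

smallUnitTrivial₁ : ∀ ε → SmallUnitTrivial 1 16 ε
smallUnitTrivial₁ = smallUnitTrivial-byBox 1 16 K (from-yes (all? (smallUnitTrivial? 1 16) (box 2 K))) inBox
  where
  K : Bound 2
  K = (2 , 2) , (2 , 1)
  inBox : ∀ a b → RE⁺ 1 (a , b) → trSqD 1 b ℤ.< + 16 → InBox 2 K (a , b)
  inBox (a₀ , a₁) (b₀ , b₁) norm small = (∣a₀∣≤2 , ∣a₁∣≤2) , (∣b₀∣≤2 , ∣b₁∣≤1)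
    where
    b< : sq (b₀ ℤ.+ b₁) ℕ.+ sq b₁ < 4
    b< = ℕP.*-cancelˡ-< 4 _ _ (<-of-≡+ (trSqD₁ b₀ b₁) small)
    ∣b₀+b₁∣≤1 : ∣ b₀ ℤ.+ b₁ ∣ ≤ 1
    ∣b₀+b₁∣≤1 = ∣∣≤-of-sq< (b₀ ℤ.+ b₁) 1 (ℕP.≤-<-trans (ℕP.m≤m+n _ _) b<)
    ∣b₁∣≤1 : ∣ b₁ ∣ ≤ 1
    ∣b₁∣≤1 = ∣∣≤-of-sq< b₁ 1 (ℕP.≤-<-trans (ℕP.m≤n+m _ _) b<)
    ∣b₀∣≤2 : ∣ b₀ ∣ ≤ 2
    ∣b₀∣≤2 = ∣∣≤-sub (b₀ ℤ.+ b₁) b₁ (x≡[x+y]-y b₀ b₁) ∣b₀+b₁∣≤1 ∣b₁∣≤1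
    a< : sq a₀ ℕ.+ 2 ℕ.* sq a₁ < 9
    a< = ℕP.*-cancelˡ-< 2 _ _ (<-of-≡+ (trSq₁ a₀ a₁) (trSq-proj₁<-RE⁺ 1 (a₀ , a₁) (b₀ , b₁) norm small))
    ∣a₀∣≤2 : ∣ a₀ ∣ ≤ 2
    ∣a₀∣≤2 = ∣∣≤-of-sq< a₀ 2 (ℕP.≤-<-trans (ℕP.m≤m+n (sq a₀) _) a<)
    ∣a₁∣≤2 : ∣ a₁ ∣ ≤ 2
    ∣a₁∣≤2 = ∣∣≤-of-sq< a₁ 2 (ℕP.≤-<-trans (ℕP.≤-trans (ℕP.m≤m+n (sq a₁) _) (ℕP.m≤n+m _ (sq a₀))) a<)

module Mod₄ = Modulo 4
module Mod₃ = Modulo 3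

b-inBox₂ : ∀ b → trSqD 2 b ℤ.< + 64 → InBox 2 ((7 , 5) , (3 , 2)) b
b-inBox₂ ((u₁ , u₂) , (v₁ , v₂)) small =
  inBox (summands< (2 ℕ.* sq L₁) (sq L₂) (sq v₁) (2 ℕ.* sq v₂) (ℕP.*-cancelˡ-< 4 _ _ (<-of-≡+ (trSqD₂ u₁ u₂ v₁ v₂) small)))
  where
  L₁ L₂ : ℤ
  L₁ = u₁ ℤ.+ v₁ ℤ.+ v₂
  L₂ = + 2 ℤ.* u₂ ℤ.+ v₁ ℤ.+ + 2 ℤ.* v₂
  u₁≡ : ∀ u₁ v₁ v₂ → u₁ ≡ (u₁ ℤ.+ v₁ ℤ.+ v₂) ℤ.- v₁ ℤ.- v₂
  u₁≡ = solve-∀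
  2u₂≡ : ∀ u₂ v₁ v₂ → + 2 ℤ.* u₂ ≡ (+ 2 ℤ.* u₂ ℤ.+ v₁ ℤ.+ + 2 ℤ.* v₂) ℤ.- v₁ ℤ.- + 2 ℤ.* v₂
  2u₂≡ = solve-∀
  inBox : 2 ℕ.* sq L₁ < 16 × sq L₂ < 16 × sq v₁ < 16 × 2 ℕ.* sq v₂ < 16 → InBox 2 ((7 , 5) , (3 , 2)) ((u₁ , u₂) , (v₁ , v₂))
  inBox (L₁< , L₂< , v₁< , v₂<) = (∣u₁∣≤7 , ∣u₂∣≤5) , (∣v₁∣≤3 , ∣v₂∣≤2)
    where
    ∣L₁∣≤2 : ∣ L₁ ∣ ≤ 2
    ∣L₁∣≤2 = ∣∣≤-of-sq< L₁ 2 (ℕP.*-cancelˡ-< 2 _ _ (ℕP.<-≤-trans L₁< (ℕP.m≤m+n 16 2)))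
    ∣L₂∣≤3 : ∣ L₂ ∣ ≤ 3
    ∣L₂∣≤3 = ∣∣≤-of-sq< L₂ 3 L₂<
    ∣v₁∣≤3 : ∣ v₁ ∣ ≤ 3
    ∣v₁∣≤3 = ∣∣≤-of-sq< v₁ 3 v₁<
    ∣v₂∣≤2 : ∣ v₂ ∣ ≤ 2
    ∣v₂∣≤2 = ∣∣≤-of-sq< v₂ 2 (ℕP.*-cancelˡ-< 2 _ _ (ℕP.<-≤-trans v₂< (ℕP.m≤m+n 16 2)))
    ∣u₁∣≤7 : ∣ u₁ ∣ ≤ 7
    ∣u₁∣≤7 = ∣∣≤-sub (L₁ ℤ.- v₁) v₂ (u₁≡ u₁ v₁ v₂) (∣∣≤-sub L₁ v₁ refl ∣L₁∣≤2 ∣v₁∣≤3) ∣v₂∣≤2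
    ∣2v₂∣≤4 : ∣ + 2 ℤ.* v₂ ∣ ≤ 4
    ∣2v₂∣≤4 = subst (_≤ 4) (sym (ℤP.∣i*j∣≡∣i∣*∣j∣ (+ 2) v₂)) (ℕP.*-monoʳ-≤ 2 ∣v₂∣≤2)
    ∣u₂∣≤5 : ∣ u₂ ∣ ≤ 5
    ∣u₂∣≤5 = ℕP.*-cancelˡ-≤ 2 (subst (_≤ 10) (ℤP.∣i*j∣≡∣i∣*∣j∣ (+ 2) u₂)
               (∣∣≤-sub (L₂ ℤ.- v₁) (+ 2 ℤ.* v₂) (2u₂≡ u₂ v₁ v₂) (∣∣≤-sub L₂ v₁ refl ∣L₂∣≤3 ∣v₁∣≤3) ∣2v₂∣≤4))

a-inBox₂ : ∀ a → RE⁺ 2 (a , ι 2 (+ 0)) → InBox 2 ((1 , 0) , (0 , 0)) a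
a-inBox₂ ((p , q) , (r , s)) norm = inBox (summands< (sq p) (2 ℕ.* sq q) (2 ℕ.* sq (r ℤ.+ s)) (2 ℕ.* sq s) a<)
  where
  a< : sq p ℕ.+ 2 ℕ.* sq q ℕ.+ 2 ℕ.* sq (r ℤ.+ s) ℕ.+ 2 ℕ.* sq s < 2
  a< = ℕP.*-cancelˡ-< 4 _ _ (ℕP.<-≤-trans
         (<-of-≡+ (trSq₂ p q r s) (trSq-proj₁<-RE⁺ 2 ((p , q) , (r , s)) (ι 2 (+ 0)) norm (ℤ.+<+ (ℕ.s≤s ℕ.z≤n))))
         (ℕP.m≤m+n 5 3))
  inBox : sq p < 2 × 2 ℕ.* sq q < 2 × 2 ℕ.* sq (r ℤ.+ s) < 2 × 2 ℕ.* sq s < 2 → InBox 2 ((1 , 0) , (0 , 0)) ((p , q) , (r , s))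
  inBox (p< , q< , r+s< , s<) = (∣p∣≤1 , ∣q∣≤0) , (∣r∣≤0 , ∣s∣≤0)
    where
    ∣p∣≤1 : ∣ p ∣ ≤ 1
    ∣p∣≤1 = ∣∣≤-of-sq< p 1 (ℕP.<-≤-trans p< (ℕP.m≤m+n 2 2))
    ∣q∣≤0 : ∣ q ∣ ≤ 0
    ∣q∣≤0 = ∣∣≤-of-sq< q 0 (ℕP.*-cancelˡ-< 2 _ _ q<)
    ∣s∣≤0 : ∣ s ∣ ≤ 0
    ∣s∣≤0 = ∣∣≤-of-sq< s 0 (ℕP.*-cancelˡ-< 2 _ _ s<)
    ∣r∣≤0 : ∣ r ∣ ≤ 0
    ∣r∣≤0 = ∣∣≤-sub (r ℤ.+ s) s (x≡[x+y]-y r s) (∣∣≤-of-sq< (r ℤ.+ s) 0 (ℕP.*-cancelˡ-< 2 _ _ r+s<)) ∣s∣≤0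

Is±1-of-b≡0 : ∀ a → RE⁺ 2 (a , ι 2 (+ 0)) → Is±1 3 (a , ι 2 (+ 0))
Is±1-of-b≡0 a norm = All.lookup checked (∈-box 2 a (a-inBox₂ a norm)) norm (ℤ.+<+ (ℕ.s≤s ℕ.z≤n))
  where
  checked : All (λ a → SmallUnitTrivial 2 1 (a , ι 2 (+ 0))) (box 2 ((1 , 0) , (0 , 0)))
  checked = from-yes (all? (λ a → smallUnitTrivial? 2 1 (a , ι 2 (+ 0))) (box 2 ((1 , 0) , (0 , 0))))

Obstructed : (S₄ S₃ : List (O 2)) → O 2 → Set
Obstructed S₄ S₃ b = b ≡ ι 2 (+ 0) ⊎ Mod₄.Avoids 2 S₄ (forcedSquare 2 b) ⊎ Mod₃.Avoids 2 S₃ (forcedSquare 2 b)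

obstructed? : ∀ S₄ S₃ b → Dec (Obstructed S₄ S₃ b)
obstructed? S₄ S₃ b = b ≟O ι 2 (+ 0) ⊎-dec Mod₄.avoids? 2 S₄ (forcedSquare 2 b) ⊎-dec Mod₃.avoids? 2 S₃ (forcedSquare 2 b)

small-b-obstructed : All (λ b → trSqD 2 b ℤ.< + 64 → Obstructed (Mod₄.squares 2) (Mod₃.squares 2) b) (box 2 ((7 , 5) , (3 , 2)))
small-b-obstructed = from-yes (decide (Mod₄.squares 2) (Mod₃.squares 2))
  where
  -- The lists of squares are passed as arguments so that evaluation computes them only once.
  decide : ∀ S₄ S₃ → Dec (All (λ b → trSqD 2 b ℤ.< + 64 → Obstructed S₄ S₃ b) (box 2 ((7 , 5) , (3 , 2))))
  decide S₄ S₃ = all? (λ b → trSqD 2 b ℤP.<? + 64 →-dec obstructed? S₄ S₃ b) (box 2 ((7 , 5) , (3 , 2)))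

smallUnitTrivial₂ : ∀ ε → SmallUnitTrivial 2 64 ε
smallUnitTrivial₂ (a , b) norm small = excluded (All.lookup small-b-obstructed (∈-box 2 b (b-inBox₂ b small)) small)
  where
  excluded : Obstructed (Mod₄.squares 2) (Mod₃.squares 2) b → Is±1 3 (a , b)
  excluded (inj₁ refl)          = Is±1-of-b≡0 a norm
  excluded (inj₂ (inj₁ avoids)) = ⊥-elim (Mod₄.avoids-squares⇒≢square 2 a avoids (sym (RE⁺⇒square 2 a b norm)))
  excluded (inj₂ (inj₂ avoids)) = ⊥-elim (Mod₃.avoids-squares⇒≢square 2 a avoids (sym (RE⁺⇒square 2 a b norm)))

corollary2p6 : (m : ℕ) → m ≤ 2 →
    (Σ (O (suc m)) λ ε → RE⁺ m ε × ε ≢ ι (suc m) (+ 1) × ε ≢ ι (suc m) (ℤ.- (+ 1))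
        × Tr (suc m) (mul (suc m) ε ε) ≡ + (2 ^ suc m ℕ.* (1 ℕ.+ 8 ℕ.* c (suc m))))
    × ((ε : O (suc m)) → RE⁺ m ε → ε ≢ ι (suc m) (+ 1) → ε ≢ ι (suc m) (ℤ.- (+ 1)) →
        + (2 ^ suc m ℕ.* (1 ℕ.+ 8 ℕ.* c (suc m))) ℤ.≤ Tr (suc m) (mul (suc m) ε ε))
corollary2p6 zero _ =
  ((+ 3 , + 2) , refl , (λ ()) , (λ ()) , refl) ,
  RE⁺-trace-lower-bound 0 8 smallUnitTrivial₀
corollary2p6 (suc zero) _ =
  (((ℤ.- + 1 , ℤ.- + 2) , (ℤ.- + 2 , + 0)) , refl , (λ ()) , (λ ()) , refl) ,
  RE⁺-trace-lower-bound 1 16 smallUnitTrivial₁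
corollary2p6 (suc (suc zero)) _ =
  ((((ℤ.- + 1 , + 0) , (+ 0 , ℤ.- + 2)) , ((ℤ.- + 4 , ℤ.- + 2) , (+ 2 , + 0))) , refl , (λ ()) , (λ ()) , refl) ,
  RE⁺-trace-lower-bound 2 64 smallUnitTrivial₂
corollary2p6 (suc (suc (suc _))) (ℕ.s≤s (ℕ.s≤s ()))
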